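{- For every integer $n\geq 3$, $c(C_n,\mathbf{1})=\lceil n/2\rceil$.
   Context: $C_n$ is the cycle on $n$ vertices with all edge weights $1$, so distances are graph distances. A binary addressing of length $m$ is a map $f:V(C_n)\to\{0,1\}^m$ with $d(u,v)\le d_H(f(u),f(v))$ for all vertices $u,v$ ($d_H$ the Hamming distance); $c(C_n,\mathbf{1})$ is the minimum length of a binary addressing. -}

module Defs where

open import Data.Nat using (ℕ; zero; suc; _+_; _∸_; _≤_; _⊓_; ∣_-_∣)
open import Data.Fin using (Fin; toℕ)
open import Data.Bool using (Bool; true; false; if_then_else_)
open import Data.Vec using (Vec; []; _∷_)
open import Data.Product using (_×_)
open import Relation.Nullary using (Dec; yes; no)
open import Data.Bool.Properties using (_≟_)

-- Graph distance in the cycle C_n on vertex set {0,…,n-1}, where i ~ i+1 (mod n),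
-- all edge weights 1: d(i,j) = min(|i-j|, n-|i-j|).
cycleDist : (n : ℕ) → Fin n → Fin n → ℕ
cycleDist n i j = ∣ toℕ i - toℕ j ∣ ⊓ (n ∸ ∣ toℕ i - toℕ j ∣)

hamming : {m : ℕ} → Vec Bool m → Vec Bool m → ℕ
hamming [] [] = 0
hamming (x ∷ xs) (y ∷ ys) with x ≟ y
... | yes _ = hamming xs ys
... | no  _ = suc (hamming xs ys)

IsBinaryAddressing : (n m : ℕ) → (Fin n → Vec Bool m) → Set
IsBinaryAddressing n m f = ∀ (u v : Fin n) → cycleDist n u v ≤ hamming (f u) (f v)

HasBinaryAddressing : (n m : ℕ) → Set
HasBinaryAddressing n m = Data.Product.Σ (Fin n → Vec Bool m) (IsBinaryAddressing n m)

-- k is the minimum length of a binary addressing of C_n, i.e. k = c(C_n, 1).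
IsMinAddressingLength : (n k : ℕ) → Set
IsMinAddressingLength n k = HasBinaryAddressing n k × (∀ m → HasBinaryAddressing n m → k ≤ m)

{-# OPTIONS --safe #-}

-- Upper bound: for n ≤ 2K, label vertex x < K by the unary word 1^x 0^(K-x) and
-- vertex K + x by its complement.  Hamming distances of these labels dominate the
-- distances in C_{2K}, which dominate those in C_n.
-- Lower bound: three vertices cutting C_n into arcs of lengths ⌊(n-1)/2⌋,
-- ⌈(n-1)/2⌉ and 1 have pairwise distances summing to n, while three binary words
-- of length m have pairwise Hamming distances summing to at most 2m, because each
-- coordinate separates either none or two of the three pairs.  So n ≤ 2m.

module Submission where

open import Defs
open import Data.Nat using (ℕ; _≤_; ⌈_/2⌉; zero; suc; _+_; _∸_; _<_; _⊓_; ∣_-_∣; ⌊_/2⌋; z≤n; s≤s; _<?_)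
open import Data.Nat.Properties
open import Data.Nat.Tactic.RingSolver using (solve-∀)
open import Algebra.Properties.CommutativeSemigroup +-commutativeSemigroup using (x∙yz≈y∙xz)
open import Data.Bool using (Bool; true; false; not)
open import Data.Vec using (Vec; []; _∷_; map)
open import Data.Fin using (Fin; zero; toℕ; fromℕ; fromℕ<)
open import Data.Fin.Properties using (toℕ<n; toℕ-fromℕ; toℕ-fromℕ<)
open import Data.Product using (_,_; Σ-syntax)
open import Data.Sum using (inj₁; inj₂)
open import Relation.Nullary using (yes; no)
open import Relation.Binary.PropositionalEquality

hamming-comm : ∀ {m} (u v : Vec Bool m) → hamming u v ≡ hamming v u
hamming-comm []          []          = refl
hamming-comm (false ∷ u) (false ∷ v) = hamming-comm u v
hamming-comm (false ∷ u) (true  ∷ v) = cong suc (hamming-comm u v)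
hamming-comm (true  ∷ u) (false ∷ v) = cong suc (hamming-comm u v)
hamming-comm (true  ∷ u) (true  ∷ v) = hamming-comm u v

hamming-map-not : ∀ {m} (u v : Vec Bool m) → hamming (map not u) (map not v) ≡ hamming u v
hamming-map-not []          []          = refl
hamming-map-not (false ∷ u) (false ∷ v) = hamming-map-not u v
hamming-map-not (false ∷ u) (true  ∷ v) = cong suc (hamming-map-not u v)
hamming-map-not (true  ∷ u) (false ∷ v) = cong suc (hamming-map-not u v)
hamming-map-not (true  ∷ u) (true  ∷ v) = hamming-map-not u v

hamming-map-notʳ+hamming : ∀ {m} (u v : Vec Bool m) → hamming u (map not v) + hamming u v ≡ m
hamming-map-notʳ+hamming []          []          = refl
hamming-map-notʳ+hamming (false ∷ u) (false ∷ v) = cong suc (hamming-map-notʳ+hamming u v)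
hamming-map-notʳ+hamming (false ∷ u) (true  ∷ v) =
  trans (+-suc _ _) (cong suc (hamming-map-notʳ+hamming u v))
hamming-map-notʳ+hamming (true  ∷ u) (false ∷ v) =
  trans (+-suc _ _) (cong suc (hamming-map-notʳ+hamming u v))
hamming-map-notʳ+hamming (true  ∷ u) (true  ∷ v) = cong suc (hamming-map-notʳ+hamming u v)

hamming-map-notʳ : ∀ {m} (u v : Vec Bool m) → hamming u (map not v) ≡ m ∸ hamming u v
hamming-map-notʳ {m} u v = begin
  hamming u (map not v)                              ≡⟨ m+n∸n≡m _ (hamming u v) ⟨
  hamming u (map not v) + hamming u v ∸ hamming u v  ≡⟨ cong (_∸ hamming u v) (hamming-map-notʳ+hamming u v) ⟩
  m ∸ hamming u v                                    ∎
  where open ≡-Reasoning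

bitDist : Bool → Bool → ℕ
bitDist false false = 0
bitDist false true  = 1
bitDist true  false = 1
bitDist true  true  = 0

hamming-∷ : ∀ {m} a b (u v : Vec Bool m) → hamming (a ∷ u) (b ∷ v) ≡ bitDist a b + hamming u v
hamming-∷ false false u v = refl
hamming-∷ false true  u v = refl
hamming-∷ true  false u v = refl
hamming-∷ true  true  u v = refl

bitDist-perimeter : ∀ a b c → bitDist a b + bitDist b c + bitDist a c ≤ 2
bitDist-perimeter false false false = z≤n
bitDist-perimeter false false true  = ≤-refl
bitDist-perimeter false true  false = ≤-refl
bitDist-perimeter false true  true  = ≤-refl
bitDist-perimeter true  false false = ≤-refl
bitDist-perimeter true  false true  = ≤-refl
bitDist-perimeter true  true  false = ≤-refl
bitDist-perimeter true  true  true  = z≤n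

hamming-perimeter : ∀ {m} (x y z : Vec Bool m) → hamming x y + hamming y z + hamming x z ≤ m + m
hamming-perimeter []          []          []          = z≤n
hamming-perimeter {suc m} (a ∷ x) (b ∷ y) (c ∷ z) = begin
  hamming (a ∷ x) (b ∷ y) + hamming (b ∷ y) (c ∷ z) + hamming (a ∷ x) (c ∷ z)
    ≡⟨ cong₂ _+_ (cong₂ _+_ (hamming-∷ a b x y) (hamming-∷ b c y z)) (hamming-∷ a c x z) ⟩
  (bitDist a b + hamming x y) + (bitDist b c + hamming y z) + (bitDist a c + hamming x z)
    ≡⟨ regroup (bitDist a b) (bitDist b c) (bitDist a c) (hamming x y) (hamming y z) (hamming x z) ⟩
  (bitDist a b + bitDist b c + bitDist a c) + (hamming x y + hamming y z + hamming x z)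
    ≤⟨ +-mono-≤ (bitDist-perimeter a b c) (hamming-perimeter x y z) ⟩
  2 + (m + m)
    ≡⟨ cong suc (+-suc m m) ⟨
  suc m + suc m ∎
  where
  open ≤-Reasoning
  regroup : ∀ a b c d e f → (a + d) + (b + e) + (c + f) ≡ (a + b + c) + (d + e + f)
  regroup = solve-∀

unary : (K x : ℕ) → Vec Bool K
unary zero    _       = []
unary (suc K) zero    = false ∷ unary K zero
unary (suc K) (suc x) = true ∷ unary K x

hamming-unary : ∀ {K x y} → x ≤ K → y ≤ K → hamming (unary K x) (unary K y) ≡ ∣ x - y ∣
hamming-unary {zero}  z≤n       z≤n       = refl
hamming-unary {suc K} z≤n       z≤n       = hamming-unary {K} z≤n z≤n
hamming-unary {suc K} z≤n       (s≤s y≤K) = cong suc (hamming-unary z≤n y≤K)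
hamming-unary {suc K} (s≤s x≤K) z≤n       = cong suc (trans (hamming-unary x≤K z≤n) (∣-∣-identityʳ _))
hamming-unary {suc K} (s≤s x≤K) (s≤s y≤K) = hamming-unary x≤K y≤K

data Half (K : ℕ) : ℕ → Set where
  lower : ∀ {x} → x < K → Half K x
  upper : ∀ x → Half K (K + x)

half : ∀ K x → Half K x
half K x with x <? K
... | yes x<K = lower x<K
... | no  x≮K = subst (Half K) (m+[n∸m]≡n (≮⇒≥ x≮K)) (upper (x ∸ K))

antipodal : (K x : ℕ) → Vec Bool K
antipodal K x with half K x
... | lower _ = unary K x
... | upper y = map not (unary K y)

cycleDistℕ : ℕ → ℕ → ℕ → ℕ
cycleDistℕ n x y = ∣ x - y ∣ ⊓ (n ∸ ∣ x - y ∣)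

cycleDistℕ-comm : ∀ n x y → cycleDistℕ n x y ≡ cycleDistℕ n y x
cycleDistℕ-comm n x y = cong (λ d → d ⊓ (n ∸ d)) (∣-∣-comm x y)

cycleDistℕ-monoˡ-≤ : ∀ {n N} x y → n ≤ N → cycleDistℕ n x y ≤ cycleDistℕ N x y
cycleDistℕ-monoˡ-≤ x y n≤N = ⊓-monoʳ-≤ ∣ x - y ∣ (∸-monoˡ-≤ ∣ x - y ∣ n≤N)

cycleDistℕ-antipode : ∀ {K x} y → x ≤ K → cycleDistℕ (K + K) x (K + y) ≤ K ∸ ∣ x - y ∣
cycleDistℕ-antipode {K} {x} y x≤K with ≤-total x y
... | inj₁ x≤y = begin
  cycleDistℕ (K + K) x (K + y) ≤⟨ m⊓n≤n _ _ ⟩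
  (K + K) ∸ ∣ x - K + y ∣      ≡⟨ cong ((K + K) ∸_) ∣x-[K+y]∣≡K+[y∸x] ⟩
  (K + K) ∸ (K + (y ∸ x))      ≡⟨ [m+n]∸[m+o]≡n∸o K K (y ∸ x) ⟩
  K ∸ (y ∸ x)                  ≡⟨ cong (K ∸_) (m≤n⇒∣m-n∣≡n∸m x≤y) ⟨
  K ∸ ∣ x - y ∣                ∎
  where
  open ≤-Reasoning
  ∣x-[K+y]∣≡K+[y∸x] : ∣ x - K + y ∣ ≡ K + (y ∸ x)
  ∣x-[K+y]∣≡K+[y∸x] = trans (m≤n⇒∣m-n∣≡n∸m (m≤n⇒m≤o+n K x≤y)) (+-∸-assoc K x≤y)
... | inj₂ y≤x = begin
  cycleDistℕ (K + K) x (K + y) ≤⟨ m⊓n≤m _ _ ⟩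
  ∣ x - K + y ∣                ≡⟨ m≤n⇒∣m-n∣≡n∸m (m≤n⇒m≤n+o y x≤K) ⟩
  K + y ∸ x                    ≡⟨ cong₂ _∸_ (+-comm K y) (sym (m+[n∸m]≡n y≤x)) ⟩
  y + K ∸ (y + (x ∸ y))        ≡⟨ [m+n]∸[m+o]≡n∸o y K (x ∸ y) ⟩
  K ∸ (x ∸ y)                  ≡⟨ cong (K ∸_) (m≤n⇒∣n-m∣≡n∸m y≤x) ⟨
  K ∸ ∣ x - y ∣                ∎
  where open ≤-Reasoning

cycleDistℕ≤hamming-unary-complement : ∀ {K x y} → x < K → y < K →
  cycleDistℕ (K + K) x (K + y) ≤ hamming (unary K x) (map not (unary K y))
cycleDistℕ≤hamming-unary-complement {K} {x} {y} x<K y<K = begin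
  cycleDistℕ (K + K) x (K + y)               ≤⟨ cycleDistℕ-antipode y (<⇒≤ x<K) ⟩
  K ∸ ∣ x - y ∣                              ≡⟨ cong (K ∸_) (hamming-unary (<⇒≤ x<K) (<⇒≤ y<K)) ⟨
  K ∸ hamming (unary K x) (unary K y)        ≡⟨ hamming-map-notʳ (unary K x) (unary K y) ⟨
  hamming (unary K x) (map not (unary K y))  ∎
  where open ≤-Reasoning

cycleDistℕ≤hamming-antipodal : ∀ {K} x y → x < K + K → y < K + K →
  cycleDistℕ (K + K) x y ≤ hamming (antipodal K x) (antipodal K y)
cycleDistℕ≤hamming-antipodal {K} x y x<2K y<2K with half K x | half K y
... | lower x<K | lower y<K =
  ≤-trans (m⊓n≤m _ _) (≤-reflexive (sym (hamming-unary (<⇒≤ x<K) (<⇒≤ y<K))))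
... | upper x′ | upper y′ = ≤-trans (m⊓n≤m _ _) (≤-reflexive (begin
  ∣ K + x′ - K + y′ ∣                                    ≡⟨ ∣m+n-m+o∣≡∣n-o∣ K x′ y′ ⟩
  ∣ x′ - y′ ∣                                            ≡⟨ hamming-unary x′≤K y′≤K ⟨
  hamming (unary K x′) (unary K y′)                      ≡⟨ hamming-map-not (unary K x′) (unary K y′) ⟨
  hamming (map not (unary K x′)) (map not (unary K y′))  ∎))
  where
  open ≡-Reasoning
  x′≤K : x′ ≤ K
  x′≤K = <⇒≤ (+-cancelˡ-< K x′ K x<2K)
  y′≤K : y′ ≤ K
  y′≤K = <⇒≤ (+-cancelˡ-< K y′ K y<2K)
... | lower x<K | upper y′ = cycleDistℕ≤hamming-unary-complement x<K (+-cancelˡ-< K y′ K y<2K)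
... | upper x′ | lower y<K = subst₂ _≤_
  (cycleDistℕ-comm (K + K) y (K + x′))
  (hamming-comm (unary K y) (map not (unary K x′)))
  (cycleDistℕ≤hamming-unary-complement y<K (+-cancelˡ-< K x′ K x<2K))

antipodal-addressing : ∀ {n K} → n ≤ K + K → HasBinaryAddressing n K
antipodal-addressing {n} {K} n≤2K = (λ u → antipodal K (toℕ u)) , λ u v →
  ≤-trans (cycleDistℕ-monoˡ-≤ (toℕ u) (toℕ v) n≤2K)
          (cycleDistℕ≤hamming-antipodal {K} (toℕ u) (toℕ v) (toℕ<K+K u) (toℕ<K+K v))
  where
  toℕ<K+K : (u : Fin n) → toℕ u < K + K
  toℕ<K+K u = <-≤-trans (toℕ<n u) n≤2K

cycleDistℕ-arc : ∀ {n} x a b → a + b ≡ n → cycleDistℕ n x (x + a) ≡ a ⊓ b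
cycleDistℕ-arc {n} x a b a+b≡n = begin
  cycleDistℕ n x (x + a) ≡⟨ cong (λ d → d ⊓ (n ∸ d)) (∣m-m+n∣≡n x a) ⟩
  a ⊓ (n ∸ a)            ≡⟨ cong (λ m → a ⊓ (m ∸ a)) a+b≡n ⟨
  a ⊓ (a + b ∸ a)        ≡⟨ cong (a ⊓_) (m+n∸m≡n a b) ⟩
  a ⊓ b                  ∎
  where open ≡-Reasoning

perimeter : ℕ → ℕ → ℕ → ℕ → ℕ
perimeter n x y z = cycleDistℕ n x y + cycleDistℕ n y z + cycleDistℕ n x z

perimeter-arcs : ∀ {p q r n} → p + q + r ≡ n → p ≤ q + r → q ≤ p + r → r ≤ p + q →
  perimeter n 0 p (p + q) ≡ n
perimeter-arcs {p} {q} {r} {n} p+q+r≡n p≤q+r q≤p+r r≤p+q = begin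
  perimeter n 0 p (p + q)
    ≡⟨ cong₂ _+_ (cong₂ _+_ (cycleDistℕ-arc 0 p (q + r) p+[q+r]≡n)
                            (cycleDistℕ-arc p q (p + r) q+[p+r]≡n))
                 (cycleDistℕ-arc 0 (p + q) r p+q+r≡n) ⟩
  p ⊓ (q + r) + q ⊓ (p + r) + (p + q) ⊓ r
    ≡⟨ cong₂ _+_ (cong₂ _+_ (m≤n⇒m⊓n≡m p≤q+r) (m≤n⇒m⊓n≡m q≤p+r)) (m≥n⇒m⊓n≡n r≤p+q) ⟩
  p + q + r
    ≡⟨ p+q+r≡n ⟩
  n ∎
  where
  open ≡-Reasoning
  p+[q+r]≡n : p + (q + r) ≡ n
  p+[q+r]≡n = trans (sym (+-assoc p q r)) p+q+r≡n
  q+[p+r]≡n : q + (p + r) ≡ n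
  q+[p+r]≡n = trans (x∙yz≈y∙xz q p r) p+[q+r]≡n

⌈n/2⌉≤1+⌊n/2⌋ : ∀ n → ⌈ n /2⌉ ≤ suc ⌊ n /2⌋
⌈n/2⌉≤1+⌊n/2⌋ n = ⌊n/2⌋-mono (n≤1+n (suc n))

balanced-triangle : ∀ {n} → 2 ≤ n →
  Σ[ u ∈ Fin n ] Σ[ v ∈ Fin n ] Σ[ w ∈ Fin n ] perimeter n (toℕ u) (toℕ v) (toℕ w) ≡ n
balanced-triangle {suc n₁} (s≤s 1≤n₁) = zero , v , fromℕ n₁ ,
  trans (cong₂ (perimeter (suc n₁) 0) v≡p w≡p+q) (perimeter-arcs p+q+1≡n p≤q+1 q≤p+1 1≤p+q)
  where
  p q : ℕ
  p = ⌊ n₁ /2⌋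
  q = ⌈ n₁ /2⌉
  p+q≡n₁ : p + q ≡ n₁
  p+q≡n₁ = ⌊n/2⌋+⌈n/2⌉≡n n₁
  v : Fin (suc n₁)
  v = fromℕ< (s≤s (⌊n/2⌋≤n n₁))
  v≡p : toℕ v ≡ p
  v≡p = toℕ-fromℕ< _
  w≡p+q : toℕ (fromℕ n₁) ≡ p + q
  w≡p+q = trans (toℕ-fromℕ n₁) (sym p+q≡n₁)
  p+q+1≡n : p + q + 1 ≡ suc n₁
  p+q+1≡n = trans (cong (_+ 1) p+q≡n₁) (+-comm n₁ 1)
  p≤q+1 : p ≤ q + 1
  p≤q+1 = m≤n⇒m≤n+o 1 (⌊n/2⌋≤⌈n/2⌉ n₁)
  q≤p+1 : q ≤ p + 1
  q≤p+1 = ≤-trans (⌈n/2⌉≤1+⌊n/2⌋ n₁) (≤-reflexive (+-comm 1 p))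
  1≤p+q : 1 ≤ p + q
  1≤p+q = subst (1 ≤_) (sym p+q≡n₁) 1≤n₁

addressing-length-≥ : ∀ {n m} → 2 ≤ n → HasBinaryAddressing n m → n ≤ m + m
addressing-length-≥ {n} {m} 2≤n (f , f-addressing) with balanced-triangle {n} 2≤n
... | u , v , w , perimeter≡n = begin
  n
    ≡⟨ perimeter≡n ⟨
  perimeter n (toℕ u) (toℕ v) (toℕ w)
    ≤⟨ +-mono-≤ (+-mono-≤ (f-addressing u v) (f-addressing v w)) (f-addressing u w) ⟩
  hamming (f u) (f v) + hamming (f v) (f w) + hamming (f u) (f w)
    ≤⟨ hamming-perimeter (f u) (f v) (f w) ⟩
  m + m ∎
  where open ≤-Reasoning

⌈n/2⌉≤m⇐n≤m+m : ∀ {n m} → n ≤ m + m → ⌈ n /2⌉ ≤ m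
⌈n/2⌉≤m⇐n≤m+m {n} {m} n≤m+m = ≤-trans (⌈n/2⌉-mono n≤m+m) (≤-reflexive (sym (n≡⌈n+n/2⌉ m)))

n≤⌈n/2⌉+⌈n/2⌉ : ∀ n → n ≤ ⌈ n /2⌉ + ⌈ n /2⌉
n≤⌈n/2⌉+⌈n/2⌉ n =
  subst (_≤ ⌈ n /2⌉ + ⌈ n /2⌉) (⌊n/2⌋+⌈n/2⌉≡n n) (+-monoˡ-≤ ⌈ n /2⌉ (⌊n/2⌋≤⌈n/2⌉ n))

lemma2 : (n : ℕ) → 3 ≤ n → IsMinAddressingLength n ⌈ n /2⌉
lemma2 n 3≤n =
  antipodal-addressing (n≤⌈n/2⌉+⌈n/2⌉ n) ,
  λ m addressing → ⌈n/2⌉≤m⇐n≤m+m (addressing-length-≥ (<⇒≤ 3≤n) addressing)
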